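{- Let $m$ be an odd positive integer and $c$ an integer relatively prime to $m$ such that the congruence $\sigma^2\equiv c\pmod m$ has a solution $\sigma_1$. Let $u$ be an integer with $2\sigma_1u\equiv1\pmod m$, and define $\sigma_{n+1}=(c-\sigma_n^2)u+\sigma_n$ for $n\ge1$. Then $\{\sigma_n\}_{n\ge1}$ is a Cauchy sequence in $D_m$ with respect to the metric $d(a,b)=|a-b|_m$.
   Context: $D_m$ is the set of rational numbers $a/b$ with $a,b$ relatively prime integers and $b$ relatively prime to $m$. For such $a/b$ with $a\neq0$, $|a/b|_m=m^{ -k}$, where $k$ is the greatest integer such that $m^k$ divides $a$; and $|0|_m=0$. -}

module Defs where

open import Data.Nat as ℕ using (ℕ; zero; suc; _^_; NonZero)
open import Data.Nat.Properties using (m^n≢0)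
open import Data.Nat.Divisibility using (_∣?_; quotient)
open import Data.Nat.Coprimality using (Coprime)
open import Data.Integer as ℤ using (ℤ; +_)
open import Data.Rational as ℚ using (ℚ; 0ℚ; _/_; ↥_; ↧ₙ_)
open import Relation.Nullary using (yes; no)

-- Multiplicity of m in a (number of times m divides a), computed with fuel.
-- For m ≥ 2 and a ≠ 0, multFuel a m a is the greatest k with m^k ∣ a
-- (fuel a suffices since m^k ≤ a).
multFuel : ℕ → ℕ → ℕ → ℕ
multFuel zero    m a = 0
multFuel (suc f) m zero = 0
multFuel (suc f) m (suc a) with m ∣? suc a
... | yes m∣a = suc (multFuel f m (quotient m∣a))
... | no  _   = 0

mult : ℕ → ℕ → ℕ
mult m a = multFuel a m a

Dm : ℕ → ℚ → Set
Dm m x = Coprime (↧ₙ x) m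

absm : (m : ℕ) → .{{NonZero m}} → ℚ → ℚ
absm m x with ↥ x
... | + zero = 0ℚ
... | a = _/_ (+ 1) (m ^ mult m (ℤ.∣ a ∣)) {{m^n≢0 m (mult m ℤ.∣ a ∣)}}

dm : (m : ℕ) → .{{NonZero m}} → ℚ → ℚ → ℚ
dm m x y = absm m (x ℚ.- y)

-- σ : sequence with σ 0 = σ₁ (i.e. index n here is paper's σ_{n+1}),
-- σ_{n+1} = (c - σ_n^2) u + σ_n
σseq : (c u σ₁ : ℤ) → ℕ → ℤ
σseq c u σ₁ zero    = σ₁
σseq c u σ₁ (suc n) = (c ℤ.- σseq c u σ₁ n ℤ.* σseq c u σ₁ n) ℤ.* u ℤ.+ σseq c u σ₁ n

IsCauchy : (m : ℕ) → .{{NonZero m}} → (ℕ → ℚ) → Set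
IsCauchy m s = (ε : ℚ) → 0ℚ ℚ.< ε →
  Σ ℕ λ N → (p q : ℕ) → N ℕ.≤ p → N ℕ.≤ q → dm m (s p) (s q) ℚ.< ε
  where open import Data.Product using (Σ)

-- Let r(s) = s² − c and let next s = s + (c − s²) u be the Newton step, so σₙ₊₁ = next σₙ.
-- Inductively σₙ ≡ σ₁ (mod m), hence 2σₙu ≡ 1 (mod m), and the identity
-- r(next s) = (1 − 2su) r(s) + r(s)² u² gives mⁿ⁺¹ ∣ r(σₙ). Consecutive terms differ by r(σₙ) u,
-- so m^N ∣ σ_p − σ_q for p, q ≥ N, i.e. d(σ_p, σ_q) ≤ m^−N, which is below ε once N is the
-- denominator of ε.
module Submission where

open import Defs
open import Data.Nat as ℕ using (ℕ; NonZero; _%_)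
open import Data.Nat.Coprimality using (Coprime)
open import Data.Integer as ℤ using (ℤ; +_)
open import Data.Integer.Divisibility using (_∣_)
open import Data.Rational as ℚ using (ℚ)
open import Data.Product using (_×_)
open import Relation.Binary.PropositionalEquality using (_≡_)

open import Data.Nat using (zero; suc; z≤n; s≤s; _≤′_; ≤′-refl; ≤′-step)
import Data.Nat.Properties as ℕ
import Data.Nat.Divisibility as ℕ
open import Data.Nat.Coprimality using (1-coprimeTo)
open import Data.Integer using (_+_; _*_; _-_; -_; _^_; 0ℤ; -[1+_]; +[1+_])
import Data.Integer.Properties as ℤ
open import Data.Integer.GCD using (gcd-zeroˡ)
open import Data.Integer.Divisibility.Signed as Signed using (divides; ∣-refl; ∣-trans)
open import Data.Integer.Tactic.RingSolver using (solve-∀)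
open import Data.Rational using (mkℚ; ↥_; ↧_; ↧ₙ_; 0ℚ; *≤*; *<*)
open import Data.Rational.Literals using (fromℤ)
import Data.Rational.Properties as ℚ
open import Data.Product using (_,_; proj₁; proj₂)
open import Relation.Binary.PropositionalEquality using (refl; sym; trans; cong; cong₂; subst; subst₂)
open import Relation.Nullary using (yes; no; contradiction)

/1≡fromℤ : ∀ z → z ℚ./ 1 ≡ fromℤ z
/1≡fromℤ z = ℚ.↥p/↧p≡p (fromℤ z)

fromℤ-neg : ∀ z → ℚ.- fromℤ z ≡ fromℤ (- z)
fromℤ-neg (+ zero) = refl
fromℤ-neg +[1+ n ] = refl
fromℤ-neg -[1+ n ] = refl

fromℤ-+ : ∀ z w → fromℤ z ℚ.+ fromℤ w ≡ fromℤ (z + w)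
fromℤ-+ z w = trans (cong (λ t → t ℚ./ 1) (cong₂ _+_ (ℤ.*-identityʳ z) (ℤ.*-identityʳ w))) (/1≡fromℤ (z + w))

fromℤ-- : ∀ z w → fromℤ z ℚ.- fromℤ w ≡ fromℤ (z - w)
fromℤ-- z w = trans (cong (fromℤ z ℚ.+_) (fromℤ-neg w)) (fromℤ-+ z (- w))

pos-^ : ∀ m n → + (m ℕ.^ n) ≡ (+ m) ^ n
pos-^ m zero = refl
pos-^ m (suc n) = trans (ℤ.pos-* m (m ℕ.^ n)) (cong ((+ m) *_) (pos-^ m n))

n<m^n : ∀ {m} → 1 ℕ.< m → ∀ n → n ℕ.< m ℕ.^ n
n<m^n 1<m zero = s≤s z≤n
n<m^n 1<m (suc n) = ℕ.≤-<-trans (n<m^n 1<m n) (ℕ.^-monoʳ-< _ 1<m (ℕ.n<1+n n))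

*-pres-∣ : ∀ {a b c d} → a Signed.∣ b → c Signed.∣ d → a * c Signed.∣ b * d
*-pres-∣ {a} {b} {c} {d} a∣b c∣d = ∣-trans (Signed.*-monoʳ-∣ a c∣d) (Signed.*-monoˡ-∣ d a∣b)

^-monoʳ-∣ : ∀ M {n p} → n ≤′ p → M ^ n Signed.∣ M ^ p
^-monoʳ-∣ M ≤′-refl = ∣-refl
^-monoʳ-∣ M (≤′-step n≤p) = Signed.∣n⇒∣m*n M (^-monoʳ-∣ M n≤p)

_^-_ : (m : ℕ) → .{{NonZero m}} → ℕ → ℚ
m ^- k = ℚ._/_ (+ 1) (m ℕ.^ k) {{ℕ.m^n≢0 m k}}

module _ (m : ℕ) .{{_ : NonZero m}} where

  ^∣⇒≤multFuel : ∀ N f a → 1 ℕ.< m → a ℕ.< f → m ℕ.^ N ℕ.∣ suc a → N ℕ.≤ multFuel f m (suc a)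
  ^∣⇒≤multFuel zero f a _ _ _ = z≤n
  ^∣⇒≤multFuel (suc N) (suc f) a 1<m (s≤s a≤f) m^N+1∣a with m ℕ.∣? suc a
  ... | no m∤a = contradiction (ℕ.∣-trans (ℕ.m∣m*n (m ℕ.^ N)) m^N+1∣a) m∤a
  ... | yes (ℕ.divides (suc q) a≡q*m) = s≤s (^∣⇒≤multFuel N f q 1<m q<f m^N∣q)
    where
    q<f : q ℕ.< f
    q<f = ℕ.≤-trans (ℕ.≤-pred (subst (suc q ℕ.<_) (sym a≡q*m) (ℕ.m<m*n (suc q) m 1<m))) a≤f
    m^N∣q : m ℕ.^ N ℕ.∣ suc q
    m^N∣q = ℕ.*-cancelˡ-∣ m (subst (m ℕ.* m ℕ.^ N ℕ.∣_) (trans a≡q*m (ℕ.*-comm (suc q) m)) m^N+1∣a)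

  ↥[m^-k]≡1 : ∀ k → ↥ (m ^- k) ≡ + 1
  ↥[m^-k]≡1 k = trans (sym (ℤ.*-identityʳ _))
    (trans (cong (↥ (m ^- k) *_) (sym (gcd-zeroˡ (+ (m ℕ.^ k))))) (ℚ.↥-/ (+ 1) (m ℕ.^ k) {{ℕ.m^n≢0 m k}}))

  ↧[m^-k]≡m^k : ∀ k → ↧ (m ^- k) ≡ + (m ℕ.^ k)
  ↧[m^-k]≡m^k k = trans (sym (ℤ.*-identityʳ _))
    (trans (cong (↧ (m ^- k) *_) (sym (gcd-zeroˡ (+ (m ℕ.^ k))))) (ℚ.↧-/ (+ 1) (m ℕ.^ k) {{ℕ.m^n≢0 m k}}))

  m^-k-antitone : ∀ {n k} → n ℕ.≤ k → m ^- k ℚ.≤ m ^- n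
  m^-k-antitone {n} {k} n≤k =
    *≤* (subst₂ ℤ._≤_ (sym (cross k n)) (sym (cross n k)) (ℤ.+≤+ (ℕ.^-monoʳ-≤ m n≤k)))
    where
    cross : ∀ i j → ↥ (m ^- i) * ↧ (m ^- j) ≡ + (m ℕ.^ j)
    cross i j = trans (cong₂ _*_ (↥[m^-k]≡1 i) (↧[m^-k]≡m^k j)) (ℤ.*-identityˡ _)

  absm≤m^-k : ∀ x N → 1 ℕ.< m → m ℕ.^ N ℕ.∣ ℤ.∣ ↥ x ∣ → absm m x ℚ.≤ m ^- N
  absm≤m^-k x N 1<m m^N∣x with ↥ x
  ... | + zero = *≤* (subst (λ t → + 0 ℤ.≤ t ℤ.* + 1) (sym (↥[m^-k]≡1 N)) (ℤ.+≤+ z≤n))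
  ... | +[1+ k ] = m^-k-antitone (^∣⇒≤multFuel N (suc k) k 1<m ℕ.≤-refl m^N∣x)
  ... | -[1+ k ] = m^-k-antitone (^∣⇒≤multFuel N (suc k) k 1<m ℕ.≤-refl m^N∣x)

  m^-↧ε<ε : ∀ ε → 1 ℕ.< m → 0ℚ ℚ.< ε → m ^- (↧ₙ ε) ℚ.< ε
  m^-↧ε<ε (mkℚ +[1+ a ] d _) 1<m _ = *<* (begin-strict
      ↥ (m ^- suc d) * + suc d     ≡⟨ trans (cong (_* + suc d) (↥[m^-k]≡1 (suc d))) (ℤ.*-identityˡ _) ⟩
      + suc d                      <⟨ ℤ.+<+ (n<m^n 1<m (suc d)) ⟩
      + (m ℕ.^ suc d)              ≤⟨ ℤ.+≤+ (ℕ.m≤n*m _ (suc a)) ⟩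
      + (suc a ℕ.* m ℕ.^ suc d)    ≡⟨ ℤ.pos-* (suc a) _ ⟩
      +[1+ a ] * + (m ℕ.^ suc d)   ≡⟨ cong (+[1+ a ] *_) (sym (↧[m^-k]≡m^k (suc d))) ⟩
      +[1+ a ] * ↧ (m ^- suc d)    ∎)
    where open ℤ.≤-Reasoning
  m^-↧ε<ε (mkℚ (+ zero) d _) 1<m (*<* (ℤ.+<+ ()))
  m^-↧ε<ε (mkℚ -[1+ a ] d _) 1<m (*<* ())

module Telescoping (M : ℤ) (s : ℕ → ℤ) (M^n∣step : ∀ n → M ^ n Signed.∣ s (suc n) - s n) where

  M^N∣s-sN : ∀ {N p} → N ≤′ p → M ^ N Signed.∣ s p - s N
  M^N∣s-sN {N} ≤′-refl = divides 0ℤ (ℤ.+-inverseʳ (s N))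
  M^N∣s-sN {N} {suc p} (≤′-step N≤p) =
    subst (M ^ N Signed.∣_) (sym (split (s (suc p)) (s p) (s N)))
      (Signed.∣m∣n⇒∣m+n (∣-trans (^-monoʳ-∣ M N≤p) (M^n∣step p)) (M^N∣s-sN N≤p))
    where
    split : ∀ x y z → x - z ≡ (x - y) + (y - z)
    split = solve-∀

  M^N∣s-s : ∀ {N p q} → N ℕ.≤ p → N ℕ.≤ q → M ^ N Signed.∣ s p - s q
  M^N∣s-s {N} {p} {q} N≤p N≤q =
    subst (M ^ N Signed.∣_) (sym (split (s p) (s q) (s N)))
      (Signed.∣m∣n⇒∣m-n (M^N∣s-sN (ℕ.≤⇒≤′ N≤p)) (M^N∣s-sN (ℕ.≤⇒≤′ N≤q)))
    where
    split : ∀ x y z → x - y ≡ (x - z) - (y - z)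
    split = solve-∀

module NewtonIteration (c u σ₁ M : ℤ)
  (M∣σ₁²-c : M Signed.∣ σ₁ * σ₁ - c) (M∣2σ₁u-1 : M Signed.∣ + 2 * σ₁ * u - + 1) where

  σ : ℕ → ℤ
  σ = σseq c u σ₁

  next : ℤ → ℤ
  next s = (c - s * s) * u + s

  residual : ℤ → ℤ
  residual s = s * s - c

  next-sub : ∀ s → next s - s ≡ - (residual s * u)
  next-sub s = identity c u s
    where
    identity : ∀ c u s → ((c - s * s) * u + s) - s ≡ - ((s * s - c) * u)
    identity = solve-∀

  next-sub-σ₁ : ∀ s → next s - σ₁ ≡ (s - σ₁) - residual s * u
  next-sub-σ₁ s = identity c u s σ₁
    where
    identity : ∀ c u s σ₁ → ((c - s * s) * u + s) - σ₁ ≡ (s - σ₁) - (s * s - c) * u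
    identity = solve-∀

  residual-next : ∀ s → residual (next s) ≡
    (+ 1 - + 2 * s * u) * residual s + residual s * residual s * (u * u)
  residual-next s = identity c u s
    where
    identity : ∀ c u s → ((c - s * s) * u + s) * ((c - s * s) * u + s) - c ≡
      (+ 1 - + 2 * s * u) * (s * s - c) + (s * s - c) * (s * s - c) * (u * u)
    identity = solve-∀

  M∣1-2su : ∀ s → M Signed.∣ s - σ₁ → M Signed.∣ + 1 - + 2 * s * u
  M∣1-2su s M∣s-σ₁ = subst (M Signed.∣_) (sym (shift u s σ₁))
    (Signed.∣m∣n⇒∣m-n (Signed.∣m⇒∣-m M∣2σ₁u-1) (Signed.∣n⇒∣m*n (+ 2 * u) M∣s-σ₁))
    where
    shift : ∀ u s σ₁ → + 1 - + 2 * s * u ≡ - (+ 2 * σ₁ * u - + 1) - (+ 2 * u) * (s - σ₁)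
    shift = solve-∀

  next-invariant : ∀ {n s} → M Signed.∣ s - σ₁ → M ^ suc n Signed.∣ residual s →
    M Signed.∣ next s - σ₁ × M ^ suc (suc n) Signed.∣ residual (next s)
  next-invariant {n} {s} M∣s-σ₁ M^n+1∣r = M∣next-σ₁ , M^n+2∣r′
    where
    M∣r : M Signed.∣ residual s
    M∣r = ∣-trans (Signed.∣m⇒∣m*n (M ^ n) ∣-refl) M^n+1∣r
    M∣next-σ₁ : M Signed.∣ next s - σ₁
    M∣next-σ₁ = subst (M Signed.∣_) (sym (next-sub-σ₁ s))
      (Signed.∣m∣n⇒∣m-n M∣s-σ₁ (Signed.∣m⇒∣m*n u M∣r))
    M^n+2∣r′ : M ^ suc (suc n) Signed.∣ residual (next s)
    M^n+2∣r′ = subst (M ^ suc (suc n) Signed.∣_) (sym (residual-next s))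
      (Signed.∣m∣n⇒∣m+n (*-pres-∣ (M∣1-2su s M∣s-σ₁) M^n+1∣r)
                        (Signed.∣m⇒∣m*n (u * u) (*-pres-∣ M∣r M^n+1∣r)))

  invariant : ∀ n → M Signed.∣ σ n - σ₁ × M ^ suc n Signed.∣ residual (σ n)
  invariant zero =
    divides 0ℤ (ℤ.+-inverseʳ σ₁) , subst (Signed._∣ residual σ₁) (sym (ℤ.*-identityʳ M)) M∣σ₁²-c
  invariant (suc n) = next-invariant {n} (proj₁ (invariant n)) (proj₂ (invariant n))

  M^n+1∣σ-step : ∀ n → M ^ suc n Signed.∣ σ (suc n) - σ n
  M^n+1∣σ-step n = subst (M ^ suc n Signed.∣_) (sym (next-sub (σ n)))
    (Signed.∣m⇒∣-m (Signed.∣m⇒∣m*n u (proj₂ (invariant n))))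

  open Telescoping M σ (λ n → ∣-trans (Signed.∣n⇒∣m*n M ∣-refl) (M^n+1∣σ-step n)) public
    renaming (M^N∣s-s to M^N∣σ-σ)

Dm-/1 : ∀ m z → Dm m (z ℚ./ 1)
Dm-/1 m z = subst (λ q → Coprime (↧ₙ q) m) (sym (/1≡fromℤ z)) (1-coprimeTo m)

-- Oddness of m and coprimality of c only serve to make σ₁ and u exist; the argument never uses them.
proposition6 : (m : ℕ) → .{{_ : NonZero m}} → 1 ℕ.< m → m % 2 ≡ 1 →
    (c : ℤ) → Coprime ℤ.∣ c ∣ m →
    (σ₁ : ℤ) → (+ m) ∣ (σ₁ ℤ.* σ₁ ℤ.- c) →
    (u : ℤ) → (+ m) ∣ (+ 2 ℤ.* σ₁ ℤ.* u ℤ.- + 1) →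
    ((n : ℕ) → Dm m (ℚ._/_ (σseq c u σ₁ n) 1)) ×
    IsCauchy m (λ n → ℚ._/_ (σseq c u σ₁ n) 1)
proposition6 m 1<m _ c _ σ₁ m∣σ₁²-c u m∣2σ₁u-1 = (λ n → Dm-/1 m (σ n)) , cauchy
  where
  open NewtonIteration c u σ₁ (+ m) (Signed.∣ᵤ⇒∣ m∣σ₁²-c) (Signed.∣ᵤ⇒∣ m∣2σ₁u-1)
  open ℚ.≤-Reasoning

  cauchy : IsCauchy m (λ n → σ n ℚ./ 1)
  cauchy ε 0<ε = N , λ p q N≤p N≤q → begin-strict
      dm m (σ p ℚ./ 1) (σ q ℚ./ 1)  ≡⟨ cong (absm m) (as-fromℤ p q) ⟩
      absm m (fromℤ (σ p - σ q))    ≤⟨ absm≤m^-k m (fromℤ (σ p - σ q)) N 1<m (m^N∣σ-σ N≤p N≤q) ⟩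
      m ^- N                        <⟨ m^-↧ε<ε m ε 1<m 0<ε ⟩
      ε                             ∎
    where
    N : ℕ
    N = ↧ₙ ε
    as-fromℤ : ∀ p q → σ p ℚ./ 1 ℚ.- σ q ℚ./ 1 ≡ fromℤ (σ p - σ q)
    as-fromℤ p q = trans (cong₂ ℚ._-_ (/1≡fromℤ (σ p)) (/1≡fromℤ (σ q))) (fromℤ-- (σ p) (σ q))
    m^N∣σ-σ : ∀ {p q} → N ℕ.≤ p → N ℕ.≤ q → m ℕ.^ N ℕ.∣ ℤ.∣ σ p - σ q ∣
    m^N∣σ-σ N≤p N≤q = Signed.∣⇒∣ᵤ (subst (Signed._∣ _) (sym (pos-^ m N)) (M^N∣σ-σ N≤p N≤q))
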